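{- Let $G_a$ and $G_b$ be two networks with the same terminal set $T$, and fix $\rho\ge1$. Suppose that whenever a demand vector $\mathbf d$ between terminals of $T$ can be routed in $G_a$ using terminal-free flow paths, the demand $\mathbf d/\rho$ can be routed in $G_b$ (by arbitrary flow paths). Then for every demand vector $\mathbf d$ between terminals of $T$ that can be routed in $G_a$, the demand $\mathbf d/\rho$ can be routed in $G_b$.
   Context: A network is an undirected graph with nonnegative edge capacities and a designated set $T$ of terminal vertices. A demand vector $\mathbf d\in\mathbb R_+^{\binom T2}$ can be routed if there is a multicommodity flow that simultaneously sends $d_{st}$ units between each pair of terminals $s,t$, with the total flow on each edge at most its capacity. A flow path is terminal-free if none of its internal vertices is a terminal; routing using terminal-free flow paths means the flow decomposes into terminal-to-terminal paths that are all terminal-free.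
   Formalization: The edge capacities, the demand vectors, the flow amounts and ρ take values in ℚ rather than in ℝ. -}

module Defs where

open import Data.Nat as ℕ using (ℕ)
open import Data.Fin as F using (Fin)
open import Data.Rational using (ℚ; 0ℚ; 1ℚ; _+_; _≤_; _<_; _÷_; NonZero; >-nonZero)
open import Data.Rational.Properties using (<-≤-trans)
open import Data.List using (List; []; _∷_; _++_; foldr; map)
open import Data.List.Relation.Unary.All using (All)
open import Data.Product using (Σ; _×_; _,_)
open import Data.Bool using (Bool; if_then_else_; _∧_; _∨_)
open import Relation.Binary.PropositionalEquality using (_≡_)
open import Relation.Nullary using (¬_)
open import Relation.Nullary.Decidable using (⌊_⌋)
open import Function.Definitions using (Injective)

-- Vertices are Fin n; the
-- (undirected) edge between u and v has capacity cap u v (symmetric,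
-- nonnegative; capacity 0 = no edge; parallel edges are merged by adding
-- their capacities).
record Network (k : ℕ) : Set where
  field
    n          : ℕ
    cap        : Fin n → Fin n → ℚ
    cap-sym    : ∀ u v → cap u v ≡ cap v u
    cap-nonneg : ∀ u v → 0ℚ ≤ cap u v
    term       : Fin k → Fin n
    term-inj   : Injective _≡_ _≡_ term

-- A demand vector indexed by unordered pairs {s,t} of distinct terminals,
-- encoded as d s t for s < t (values with s ≥ t are ignored).
Demand : ℕ → Set
Demand k = Fin k → Fin k → ℚ

IsDemand : ∀ {k} → Demand k → Set
IsDemand d = ∀ s t → s F.< t → 0ℚ ≤ d s t

sumℚ : List ℚ → ℚ
sumℚ = foldr _+_ 0ℚ

steps : ∀ {A : Set} → List A → List (A × A)
steps []            = []
steps (x ∷ [])      = []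
steps (x ∷ y ∷ xs)  = (x , y) ∷ steps (y ∷ xs)

module _ {k : ℕ} (N : Network k) where
  open Network N

  record FlowPath : Set where
    field
      src tgt : Fin k
      src<tgt : src F.< tgt
      inner   : List (Fin n)
      amount  : ℚ

  open FlowPath public

  vertices : FlowPath → List (Fin n)
  vertices p = term (src p) ∷ (inner p ++ (term (tgt p) ∷ []))

  usesEdge : Fin n → Fin n → Fin n × Fin n → Bool
  usesEdge u v (x , y) =
    (⌊ x F.≟ u ⌋ ∧ ⌊ y F.≟ v ⌋) ∨ (⌊ x F.≟ v ⌋ ∧ ⌊ y F.≟ u ⌋)

  -- flow of one path on edge {u,v} (counted with multiplicity)
  pathLoad : Fin n → Fin n → FlowPath → ℚ
  pathLoad u v p =
    sumℚ (map (λ e → if usesEdge u v e then amount p else 0ℚ) (steps (vertices p)))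

  -- A (path-decomposed) multicommodity flow is a finite list of flow paths.
  load : List FlowPath → Fin n → Fin n → ℚ
  load P u v = sumℚ (map (pathLoad u v) P)

  sent : List FlowPath → Fin k → Fin k → ℚ
  sent P s t =
    sumℚ (map (λ p → if ⌊ src p F.≟ s ⌋ ∧ ⌊ tgt p F.≟ t ⌋ then amount p else 0ℚ) P)

  Routes : Demand k → List FlowPath → Set
  Routes d P =
    All (λ p → 0ℚ ≤ amount p) P
    × (∀ u v → load P u v ≤ cap u v)
    × (∀ s t → s F.< t → sent P s t ≡ d s t)

  TerminalFree : FlowPath → Set
  TerminalFree p = All (λ v → ∀ i → ¬ (term i ≡ v)) (inner p)

  Routable : Demand k → Set
  Routable d = Σ (List FlowPath) (λ P → Routes d P)

  RoutableTerminalFree : Demand k → Set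
  RoutableTerminalFree d =
    Σ (List FlowPath) (λ P → Routes d P × All TerminalFree P)

0<1 : 0ℚ < 1ℚ
0<1 = Data.Rational.*<* (Data.Integer.+<+ (ℕ.s≤s ℕ.z≤n))
  where import Data.Integer

scaleDown : ∀ {k} (ρ : ℚ) → 1ℚ ≤ ρ → Demand k → Demand k
scaleDown ρ 1≤ρ d s t = _÷_ (d s t) ρ {{>-nonZero (<-≤-trans 0<1 1≤ρ)}}

{-# OPTIONS --safe #-}

-- Induct on the total number of inner vertices of the paths routing d in Ga.  If no path has a
-- terminal among its inner vertices, the hypothesis applies.  Otherwise cut such a path s ⇝ j ⇝ t
-- at the terminal j: no load grows, fewer inner vertices remain, and the a units between s and t
-- become a units between s and j plus a units between j and t.  By induction the scaled-down
-- demand is routable in Gb.  There, split off x = a/ρ units proportionally from the s–j paths and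
-- from the j–t paths, and concatenate every s–j piece (weight w) with every j–t piece (weight w′)
-- at j, with weight w w′ / x: the joined walks carry x units between s and t and put on every edge
-- exactly the load of the pieces they replace.

module Submission where

open import Defs
open import Data.Nat using (ℕ)
open import Data.Rational using (ℚ; 1ℚ; _≤_)

import Algebra.Properties.Group as GroupProperties
open import Data.Bool using (true; false; if_then_else_; _∧_; _∨_)
import Data.Bool.Properties as BoolP
open import Data.Empty using (⊥-elim)
open import Data.Fin as F using (Fin)
import Data.Fin.Properties as FinP
open import Data.List using (List; []; _∷_; _++_; map; concatMap; length; reverse; _∷ʳ_)
import Data.List.Properties as ListP
open import Data.List.Membership.Propositional using (_∈_; find)
open import Data.List.Membership.Propositional.Properties using (∈-∃++)
open import Data.List.Relation.Unary.All as All using (All; []; _∷_)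
import Data.List.Relation.Unary.All.Properties as AllP
open import Data.List.Relation.Unary.Any using (any?)
open import Data.List.Relation.Binary.Permutation.Propositional using (_↭_; ↭⇒↭ₛ)
open import Data.List.Relation.Binary.Permutation.Propositional.Properties
  using (All-resp-↭; shift; map⁺)
open import Data.List.Relation.Binary.Permutation.Setoid.Properties using (foldr-commMonoid)
import Data.Nat as ℕ
import Data.Nat.Properties as ℕP
open import Data.Nat.Induction using (<-wellFounded)
open import Data.Nat.ListAction using (sum)
open import Data.Nat.ListAction.Properties using (sum-++; sum-↭)
open import Data.Product using (∃; _×_; _,_; proj₁; proj₂)
open import Data.Rational using (0ℚ; _+_; _*_; _-_; -_; _<_; 1/_; _÷_; NonZero; >-nonZero; nonNegative; positive)
import Data.Rational.Properties as ℚP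
open import Data.Rational.Solver using (module +-*-Solver)
open import Data.Sum using (_⊎_; inj₁; inj₂)
open import Function using (_∘_)
open import Induction.WellFounded using (Acc; acc)
open import Relation.Binary using (tri<; tri≈; tri>)
open import Relation.Binary.PropositionalEquality
  using (_≡_; _≢_; refl; sym; trans; cong; cong₂; subst; setoid; module ≡-Reasoning)
open import Relation.Nullary using (¬_; yes; no)
open import Relation.Nullary.Decidable using (⌊_⌋)

open +-*-Solver using (solve; _:+_; _:*_; _:-_; _:=_)
open GroupProperties ℚP.+-0-group using () renaming (∙-cancelʳ to +-cancelʳ)

*-nonNeg : ∀ {a b} → 0ℚ ≤ a → 0ℚ ≤ b → 0ℚ ≤ a * b
*-nonNeg {a} {b} 0≤a 0≤b =
  ℚP.nonNegative⁻¹ (a * b) {{ℚP.nonNeg*nonNeg⇒nonNeg a {{nonNegative 0≤a}} b {{nonNegative 0≤b}}}}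

1/-nonNeg : ∀ x .{{_ : NonZero x}} → 0ℚ < x → 0ℚ ≤ 1/ x
1/-nonNeg x 0<x = ℚP.<⇒≤ (ℚP.positive⁻¹ _ {{ℚP.1/pos⇒pos x {{positive 0<x}}}})

p≤q⇒0≤q-p : ∀ {p q} → p ≤ q → 0ℚ ≤ q - p
p≤q⇒0≤q-p {p} {q} p≤q = subst (_≤ q - p) (ℚP.+-inverseʳ p) (ℚP.+-monoˡ-≤ (- p) p≤q)

p≤p+q : ∀ {p q} → 0ℚ ≤ q → p ≤ p + q
p≤p+q {p} {q} 0≤q = subst (_≤ p + q) (ℚP.+-identityʳ p) (ℚP.+-monoʳ-≤ p 0≤q)

if-scale : ∀ b a → (if b then a else 0ℚ) ≡ a * (if b then 1ℚ else 0ℚ)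
if-scale true  a = sym (ℚP.*-identityʳ a)
if-scale false a = sym (ℚP.*-zeroʳ a)

if-≤ : ∀ b {a} → 0ℚ ≤ a → (if b then a else 0ℚ) ≤ a
if-≤ true  _   = ℚP.≤-refl
if-≤ false 0≤a = 0≤a

if-nonNeg : ∀ b {a} → 0ℚ ≤ a → 0ℚ ≤ (if b then a else 0ℚ)
if-nonNeg true  0≤a = 0≤a
if-nonNeg false _   = ℚP.≤-refl

zero-weight : ∀ {w} x y → w ≡ 0ℚ → w * x ≡ w * y
zero-weight x y refl = trans (ℚP.*-zeroˡ x) (sym (ℚP.*-zeroˡ y))

module _ {A : Set} where

  ∑ : (A → ℚ) → List A → ℚ
  ∑ f xs = sumℚ (map f xs)

  ∑-++ : ∀ f xs ys → ∑ f (xs ++ ys) ≡ ∑ f xs + ∑ f ys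
  ∑-++ f []       ys = sym (ℚP.+-identityˡ _)
  ∑-++ f (x ∷ xs) ys = trans (cong (f x +_) (∑-++ f xs ys)) (sym (ℚP.+-assoc (f x) _ _))

  ∑-cong : ∀ {f g} → (∀ x → f x ≡ g x) → ∀ xs → ∑ f xs ≡ ∑ g xs
  ∑-cong f≡g []       = refl
  ∑-cong f≡g (x ∷ xs) = cong₂ _+_ (f≡g x) (∑-cong f≡g xs)

  ∑-nonNeg : ∀ {f xs} → All (λ x → 0ℚ ≤ f x) xs → 0ℚ ≤ ∑ f xs
  ∑-nonNeg []           = ℚP.≤-refl
  ∑-nonNeg (0≤fx ∷ 0≤f) = ℚP.+-mono-≤ 0≤fx (∑-nonNeg 0≤f)

  ∑-+ : ∀ f g xs → ∑ (λ x → f x + g x) xs ≡ ∑ f xs + ∑ g xs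
  ∑-+ f g []       = refl
  ∑-+ f g (x ∷ xs) = trans (cong (f x + g x +_) (∑-+ f g xs))
    (solve 4 (λ a b c d → (a :+ b) :+ (c :+ d) := (a :+ c) :+ (b :+ d)) refl
      (f x) (g x) (∑ f xs) (∑ g xs))

  ∑-*ˡ : ∀ c f xs → ∑ (λ x → c * f x) xs ≡ c * ∑ f xs
  ∑-*ˡ c f []       = sym (ℚP.*-zeroʳ c)
  ∑-*ˡ c f (x ∷ xs) = trans (cong (c * f x +_) (∑-*ˡ c f xs)) (sym (ℚP.*-distribˡ-+ c (f x) (∑ f xs)))

  ∑-*ʳ : ∀ c f xs → ∑ (λ x → f x * c) xs ≡ ∑ f xs * c
  ∑-*ʳ c f xs = trans (∑-cong (λ x → ℚP.*-comm (f x) c) xs) (trans (∑-*ˡ c f xs) (ℚP.*-comm c (∑ f xs)))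

  ∑-↭ : ∀ f {xs ys} → xs ↭ ys → ∑ f xs ≡ ∑ f ys
  ∑-↭ f xs↭ys = foldr-commMonoid (setoid ℚ) ℚP.+-0-isCommutativeMonoid (↭⇒↭ₛ (map⁺ f xs↭ys))

module _ {A B : Set} where

  ∑-map : ∀ f (g : A → B) xs → ∑ f (map g xs) ≡ ∑ (f ∘ g) xs
  ∑-map f g xs = cong sumℚ (sym (ListP.map-∘ xs))

  ∑-concatMap : ∀ f (g : A → List B) xs → ∑ f (concatMap g xs) ≡ ∑ (λ x → ∑ f (g x)) xs
  ∑-concatMap f g []       = refl
  ∑-concatMap f g (x ∷ xs) = trans (∑-++ f (g x) (concatMap g xs)) (cong (∑ f (g x) +_) (∑-concatMap f g xs))

  ∑-product : ∀ (f : A → ℚ) (g : B → ℚ) xs ys → ∑ (λ x → ∑ (λ y → f x * g y) ys) xs ≡ ∑ f xs * ∑ g ys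
  ∑-product f g xs ys = trans (∑-cong (λ x → ∑-*ˡ (f x) g ys) xs) (∑-*ʳ (∑ g ys) f xs)

module _ {A : Set} (f : A × A → ℚ) where

  ∑-steps-split : ∀ xs y ys →
                  ∑ f (steps (xs ++ y ∷ ys)) ≡ ∑ f (steps (xs ++ y ∷ [])) + ∑ f (steps (y ∷ ys))
  ∑-steps-split []            y ys = sym (ℚP.+-identityˡ _)
  ∑-steps-split (x ∷ [])      y ys = cong (_+ ∑ f (steps (y ∷ ys))) (sym (ℚP.+-identityʳ (f (x , y))))
  ∑-steps-split (x ∷ x′ ∷ xs) y ys =
    trans (cong (f (x , x′) +_) (∑-steps-split (x′ ∷ xs) y ys)) (sym (ℚP.+-assoc (f (x , x′)) _ _))

  ∑-steps-reverse : (∀ x y → f (x , y) ≡ f (y , x)) → ∀ xs → ∑ f (steps (reverse xs)) ≡ ∑ f (steps xs)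
  ∑-steps-reverse f-sym []           = refl
  ∑-steps-reverse f-sym (x ∷ [])     = refl
  ∑-steps-reverse f-sym (x ∷ y ∷ xs) = begin
    ∑ f (steps (reverse (x ∷ y ∷ xs)))
      ≡⟨ cong (∑ f ∘ steps) reverse-xyxs ⟩
    ∑ f (steps (reverse xs ++ y ∷ x ∷ []))
      ≡⟨ ∑-steps-split (reverse xs) y (x ∷ []) ⟩
    ∑ f (steps (reverse xs ++ y ∷ [])) + (f (y , x) + 0ℚ)
      ≡⟨ cong₂ _+_ (cong (∑ f ∘ steps) (sym (ListP.unfold-reverse y xs))) (ℚP.+-identityʳ _) ⟩
    ∑ f (steps (reverse (y ∷ xs))) + f (y , x)
      ≡⟨ cong₂ _+_ (∑-steps-reverse f-sym (y ∷ xs)) (f-sym y x) ⟩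
    ∑ f (steps (y ∷ xs)) + f (x , y)
      ≡⟨ ℚP.+-comm _ (f (x , y)) ⟩
    ∑ f (steps (x ∷ y ∷ xs)) ∎
    where
    open ≡-Reasoning
    reverse-xyxs : reverse (x ∷ y ∷ xs) ≡ reverse xs ++ y ∷ x ∷ []
    reverse-xyxs = begin
      reverse (x ∷ y ∷ xs)    ≡⟨ ListP.unfold-reverse x (y ∷ xs) ⟩
      reverse (y ∷ xs) ∷ʳ x   ≡⟨ cong (_∷ʳ x) (ListP.unfold-reverse y xs) ⟩
      (reverse xs ∷ʳ y) ∷ʳ x  ≡⟨ ListP.++-assoc (reverse xs) (y ∷ []) (x ∷ []) ⟩
      reverse xs ++ y ∷ x ∷ [] ∎

module _ {k : ℕ} where

  -- The summand of Defs.sent, so that sent N P α β is definitionally a ∑ of orientedDemands.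
  orientedDemand : Fin k → Fin k → ℚ → Demand k
  orientedDemand s t a α β = if ⌊ s F.≟ α ⌋ ∧ ⌊ t F.≟ β ⌋ then a else 0ℚ

  pairDemand : Fin k → Fin k → ℚ → Demand k
  pairDemand s t a with FinP.<-cmp s t
  ... | tri< _ _ _ = orientedDemand s t a
  ... | tri≈ _ _ _ = λ _ _ → 0ℚ
  ... | tri> _ _ _ = orientedDemand t s a

  _+ᵈ_ : Demand k → Demand k → Demand k
  (d +ᵈ e) s t = d s t + e s t

  _≈ᵈ_ : Demand k → Demand k → Set
  d ≈ᵈ e = ∀ s t → s F.< t → d s t ≡ e s t

  _≤ᵈ_ : Demand k → Demand k → Set
  d ≤ᵈ e = ∀ s t → s F.< t → d s t ≤ e s t

  orientedDemand-self : ∀ s t a → orientedDemand s t a s t ≡ a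
  orientedDemand-self s t a with s F.≟ s | t F.≟ t
  ... | yes _   | yes _   = refl
  ... | no s≢s  | _       = ⊥-elim (s≢s refl)
  ... | yes _   | no t≢t  = ⊥-elim (t≢t refl)

  pairDemand-< : ∀ {s t} a α β → s F.< t → pairDemand s t a α β ≡ orientedDemand s t a α β
  pairDemand-< {s} {t} a α β s<t with FinP.<-cmp s t
  ... | tri< _ _ _    = refl
  ... | tri≈ _ s≡t _  = ⊥-elim (FinP.<⇒≢ s<t s≡t)
  ... | tri> _ _ t<s  = ⊥-elim (FinP.<-asym s<t t<s)

  pairDemand-> : ∀ {s t} a α β → t F.< s → pairDemand s t a α β ≡ orientedDemand t s a α β
  pairDemand-> {s} {t} a α β t<s with FinP.<-cmp s t
  ... | tri< s<t _ _  = ⊥-elim (FinP.<-asym s<t t<s)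
  ... | tri≈ _ s≡t _  = ⊥-elim (FinP.<⇒≢ t<s (sym s≡t))
  ... | tri> _ _ _    = refl

  pairDemand-self : ∀ s a α β → pairDemand s s a α β ≡ 0ℚ
  pairDemand-self s a α β with FinP.<-cmp s s
  ... | tri< _ s≢s _ = ⊥-elim (s≢s refl)
  ... | tri≈ _ _ _   = refl
  ... | tri> _ s≢s _ = ⊥-elim (s≢s refl)

  pairDemand-sym : ∀ s t a α β → pairDemand s t a α β ≡ pairDemand t s a α β
  pairDemand-sym s t a α β with FinP.<-cmp s t
  ... | tri< s<t _ _  = sym (pairDemand-> a α β s<t)
  ... | tri≈ _ refl _ = sym (pairDemand-self s a α β)
  ... | tri> _ _ t<s  = sym (pairDemand-< a α β t<s)

  pairDemand-scale : ∀ s t a α β → pairDemand s t a α β ≡ a * pairDemand s t 1ℚ α β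
  pairDemand-scale s t a α β with FinP.<-cmp s t
  ... | tri< _ _ _ = if-scale _ a
  ... | tri≈ _ _ _ = sym (ℚP.*-zeroʳ a)
  ... | tri> _ _ _ = if-scale _ a

  pairDemand-0 : ∀ s t α β → pairDemand s t 0ℚ α β ≡ 0ℚ
  pairDemand-0 s t α β = trans (pairDemand-scale s t 0ℚ α β) (ℚP.*-zeroˡ (pairDemand s t 1ℚ α β))

  pairDemand-*ʳ : ∀ s t a c α β → pairDemand s t a α β * c ≡ pairDemand s t (a * c) α β
  pairDemand-*ʳ s t a c α β = begin
    pairDemand s t a α β * c   ≡⟨ cong (_* c) (pairDemand-scale s t a α β) ⟩
    a * unit * c               ≡⟨ solve 3 (λ a u c → a :* u :* c := (a :* c) :* u) refl a unit c ⟩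
    a * c * unit               ≡⟨ sym (pairDemand-scale s t (a * c) α β) ⟩
    pairDemand s t (a * c) α β ∎
    where
    open ≡-Reasoning
    unit = pairDemand s t 1ℚ α β

  pairDemand-+ : ∀ s t a b α β → pairDemand s t (a + b) α β ≡ pairDemand s t a α β + pairDemand s t b α β
  pairDemand-+ s t a b α β = begin
    pairDemand s t (a + b) α β ≡⟨ pairDemand-scale s t (a + b) α β ⟩
    (a + b) * unit             ≡⟨ ℚP.*-distribʳ-+ unit a b ⟩
    a * unit + b * unit        ≡⟨ sym (cong₂ _+_ (pairDemand-scale s t a α β) (pairDemand-scale s t b α β)) ⟩
    pairDemand s t a α β + pairDemand s t b α β ∎
    where
    open ≡-Reasoning
    unit = pairDemand s t 1ℚ α β

  ∑-pairDemand : ∀ {A : Set} s t (f : A → ℚ) xs α β →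
                 ∑ (λ x → pairDemand s t (f x) α β) xs ≡ pairDemand s t (∑ f xs) α β
  ∑-pairDemand s t f xs α β = begin
    ∑ (λ x → pairDemand s t (f x) α β) xs ≡⟨ ∑-cong (λ x → pairDemand-scale s t (f x) α β) xs ⟩
    ∑ (λ x → f x * unit) xs               ≡⟨ ∑-*ʳ unit f xs ⟩
    ∑ f xs * unit                         ≡⟨ sym (pairDemand-scale s t (∑ f xs) α β) ⟩
    pairDemand s t (∑ f xs) α β ∎
    where
    open ≡-Reasoning
    unit = pairDemand s t 1ℚ α β

  pairDemand-nonNeg : ∀ s t {a} α β → 0ℚ ≤ a → 0ℚ ≤ pairDemand s t a α β
  pairDemand-nonNeg s t α β 0≤a with FinP.<-cmp s t
  ... | tri< _ _ _ = if-nonNeg _ 0≤a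
  ... | tri≈ _ _ _ = ℚP.≤-refl
  ... | tri> _ _ _ = if-nonNeg _ 0≤a

  pairDemand-≤ᵈ : ∀ {s t x d e} → d ≈ᵈ (pairDemand s t x +ᵈ e) → IsDemand e → pairDemand s t x ≤ᵈ d
  pairDemand-≤ᵈ d≈ e≥0 α β α<β = subst (_ ≤_) (sym (d≈ α β α<β)) (p≤p+q (e≥0 α β α<β))

  IsDemand-pairDemand-+ᵈ : ∀ {s t x e} → 0ℚ ≤ x → IsDemand e → IsDemand (pairDemand s t x +ᵈ e)
  IsDemand-pairDemand-+ᵈ {s} {t} 0≤x e≥0 α β α<β = ℚP.+-mono-≤ (pairDemand-nonNeg s t α β 0≤x) (e≥0 α β α<β)

-- Flows, walks and segments

-- A weighted walk whose end terminals are supplied separately, so that it can be read either way.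
record Segment (V : Set) : Set where
  constructor segment
  field
    interior : List V
    weight   : ℚ

open Segment

reverseSegment : ∀ {V} → Segment V → Segment V
reverseSegment σ = segment (reverse (interior σ)) (weight σ)

usesEdge-sym : ∀ {k} (N : Network k) u v x y → usesEdge N u v (x , y) ≡ usesEdge N u v (y , x)
usesEdge-sym N u v x y =
  trans (cong₂ _∨_ (BoolP.∧-comm ⌊ x F.≟ u ⌋ ⌊ y F.≟ v ⌋) (BoolP.∧-comm ⌊ x F.≟ v ⌋ ⌊ y F.≟ u ⌋))
        (BoolP.∨-comm (⌊ y F.≟ v ⌋ ∧ ⌊ x F.≟ u ⌋) (⌊ y F.≟ u ⌋ ∧ ⌊ x F.≟ v ⌋))

module _ {k : ℕ} (N : Network k) where
  open Network N

  AmountsNonNeg : List (FlowPath N) → Set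
  AmountsNonNeg P = All (λ p → 0ℚ ≤ amount p) P

  load-++ : ∀ P Q u v → load N (P ++ Q) u v ≡ load N P u v + load N Q u v
  load-++ P Q u v = ∑-++ (pathLoad N u v) P Q

  sent-++ : ∀ P Q α β → sent N (P ++ Q) α β ≡ sent N P α β + sent N Q α β
  sent-++ P Q α β = ∑-++ (λ p → orientedDemand (src p) (tgt p) (amount p) α β) P Q

  Routable-resp-≈ᵈ : ∀ {d e} → d ≈ᵈ e → Routable N d → Routable N e
  Routable-resp-≈ᵈ d≈e (P , nonNeg , fits , sends) =
    P , nonNeg , fits , λ s t s<t → trans (sends s t s<t) (d≈e s t s<t)

  sent-nonNeg : ∀ {P} → AmountsNonNeg P → ∀ α β → 0ℚ ≤ sent N P α β
  sent-nonNeg nonNeg α β = ∑-nonNeg (All.map (if-nonNeg _) nonNeg)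

  Routes⇒IsDemand : ∀ {d P} → Routes N d P → IsDemand d
  Routes⇒IsDemand (nonNeg , _ , sends) s t s<t = subst (0ℚ ≤_) (sends s t s<t) (sent-nonNeg nonNeg s t)

  Routes-resp-↭ : ∀ {d P Q} → P ↭ Q → Routes N d P → Routes N d Q
  Routes-resp-↭ P↭Q (nonNeg , fits , sends) =
    All-resp-↭ P↭Q nonNeg ,
    (λ u v → subst (_≤ cap u v) (∑-↭ _ P↭Q) (fits u v)) ,
    (λ s t s<t → trans (sym (∑-↭ _ P↭Q)) (sends s t s<t))

  sent-∷ : ∀ p P α β → sent N (p ∷ P) α β ≡ pairDemand (src p) (tgt p) (amount p) α β + sent N P α β
  sent-∷ p P α β = cong (_+ sent N P α β) (sym (pairDemand-< (amount p) α β (src<tgt p)))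

  walk : Fin k → Fin k → List (Fin n) → List (Fin n)
  walk s t i = term s ∷ (i ++ term t ∷ [])

  edgeIndicator : Fin n → Fin n → Fin n × Fin n → ℚ
  edgeIndicator u v e = if usesEdge N u v e then 1ℚ else 0ℚ

  traversals : List (Fin n) → Fin n → Fin n → ℚ
  traversals w u v = ∑ (edgeIndicator u v) (steps w)

  traversals-nonNeg : ∀ w u v → 0ℚ ≤ traversals w u v
  traversals-nonNeg w u v = ∑-nonNeg (All.universal (λ e → if-nonNeg (usesEdge N u v e) (ℚP.<⇒≤ 0<1)) (steps w))

  traversals-reverse : ∀ w u v → traversals (reverse w) u v ≡ traversals w u v
  traversals-reverse w u v =
    ∑-steps-reverse (edgeIndicator u v) (λ x y → cong (λ b → if b then 1ℚ else 0ℚ) (usesEdge-sym N u v x y)) w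

  traversals-split : ∀ s j t i₁ i₂ u v →
    traversals (walk s t (i₁ ++ term j ∷ i₂)) u v ≡ traversals (walk s j i₁) u v + traversals (walk j t i₂) u v
  traversals-split s j t i₁ i₂ u v =
    trans (cong (λ w → traversals (term s ∷ w) u v) (ListP.++-assoc i₁ (term j ∷ i₂) (term t ∷ [])))
          (∑-steps-split (edgeIndicator u v) (term s ∷ i₁) (term j) (i₂ ++ term t ∷ []))

  segmentLoad : Fin k → Fin k → Segment (Fin n) → Fin n → Fin n → ℚ
  segmentLoad s t σ u v = weight σ * traversals (walk s t (interior σ)) u v

  segmentOf : FlowPath N → Segment (Fin n)
  segmentOf p = segment (inner p) (amount p)

  pathLoad≡segmentLoad : ∀ p u v → pathLoad N u v p ≡ segmentLoad (src p) (tgt p) (segmentOf p) u v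
  pathLoad≡segmentLoad p u v =
    trans (∑-cong (λ e → if-scale (usesEdge N u v e) (amount p)) (steps (vertices N p)))
          (∑-*ˡ (amount p) (edgeIndicator u v) (steps (vertices N p)))

  segmentLoad-reverse : ∀ s t σ u v → segmentLoad s t (reverseSegment σ) u v ≡ segmentLoad t s σ u v
  segmentLoad-reverse s t σ u v = cong (weight σ *_) (begin
    traversals (walk s t (reverse (interior σ))) u v   ≡⟨ cong (λ w → traversals w u v) walk-reverse ⟩
    traversals (reverse (walk t s (interior σ))) u v   ≡⟨ traversals-reverse (walk t s (interior σ)) u v ⟩
    traversals (walk t s (interior σ)) u v             ∎)
    where
    open ≡-Reasoning
    walk-reverse : walk s t (reverse (interior σ)) ≡ reverse (walk t s (interior σ))
    walk-reverse = sym (begin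
      reverse (term t ∷ (interior σ ++ term s ∷ []))
        ≡⟨ ListP.unfold-reverse (term t) (interior σ ++ term s ∷ []) ⟩
      reverse (interior σ ++ term s ∷ []) ∷ʳ term t
        ≡⟨ cong (_∷ʳ term t) (ListP.reverse-++ (interior σ) (term s ∷ [])) ⟩
      walk s t (reverse (interior σ)) ∎)

  pathAlong : (s t : Fin k) → s F.< t → Segment (Fin n) → FlowPath N
  pathAlong s t s<t σ =
    record { src = s ; tgt = t ; src<tgt = s<t ; inner = interior σ ; amount = weight σ }

  -- A FlowPath needs src < tgt: the walk is stored reversed when t < s and dropped when s ≡ t.
  flowAlong : Fin k → Fin k → Segment (Fin n) → List (FlowPath N)
  flowAlong s t σ with FinP.<-cmp s t
  ... | tri< s<t _ _ = pathAlong s t s<t σ ∷ []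
  ... | tri≈ _ _ _   = []
  ... | tri> _ _ t<s = pathAlong t s t<s (reverseSegment σ) ∷ []

  flowAlong-nonNeg : ∀ s t σ → 0ℚ ≤ weight σ → AmountsNonNeg (flowAlong s t σ)
  flowAlong-nonNeg s t σ 0≤w with FinP.<-cmp s t
  ... | tri< _ _ _ = 0≤w ∷ []
  ... | tri≈ _ _ _ = []
  ... | tri> _ _ _ = 0≤w ∷ []

  load-flowAlong : ∀ s t σ → 0ℚ ≤ weight σ → ∀ u v → load N (flowAlong s t σ) u v ≤ segmentLoad s t σ u v
  load-flowAlong s t σ 0≤w u v with FinP.<-cmp s t
  ... | tri< s<t _ _ = ℚP.≤-reflexive
        (trans (ℚP.+-identityʳ _) (pathLoad≡segmentLoad (pathAlong s t s<t σ) u v))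
  ... | tri≈ _ _ _   = *-nonNeg 0≤w (traversals-nonNeg (walk s t (interior σ)) u v)
  ... | tri> _ _ t<s = ℚP.≤-reflexive
        (trans (ℚP.+-identityʳ _) (trans (pathLoad≡segmentLoad (pathAlong t s t<s (reverseSegment σ)) u v)
                                         (segmentLoad-reverse t s σ u v)))

  load-flowAlong-≢ : ∀ {s t} σ → s ≢ t → ∀ u v → load N (flowAlong s t σ) u v ≡ segmentLoad s t σ u v
  load-flowAlong-≢ {s} {t} σ s≢t u v with FinP.<-cmp s t
  ... | tri< s<t _ _ = trans (ℚP.+-identityʳ _) (pathLoad≡segmentLoad (pathAlong s t s<t σ) u v)
  ... | tri≈ _ s≡t _ = ⊥-elim (s≢t s≡t)
  ... | tri> _ _ t<s = trans (ℚP.+-identityʳ _)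
        (trans (pathLoad≡segmentLoad (pathAlong t s t<s (reverseSegment σ)) u v) (segmentLoad-reverse t s σ u v))

  sent-flowAlong : ∀ s t σ α β → sent N (flowAlong s t σ) α β ≡ pairDemand s t (weight σ) α β
  sent-flowAlong s t σ α β with FinP.<-cmp s t
  ... | tri< _ _ _ = ℚP.+-identityʳ _
  ... | tri≈ _ _ _ = refl
  ... | tri> _ _ _ = ℚP.+-identityʳ _

  innerSize : List (FlowPath N) → ℕ
  innerSize P = sum (map (length ∘ inner) P)

  innerSize-++ : ∀ P Q → innerSize (P ++ Q) ≡ innerSize P ℕ.+ innerSize Q
  innerSize-++ P Q = trans (cong sum (ListP.map-++ (length ∘ inner) P Q)) (sum-++ (map (length ∘ inner) P) _)

  innerSize-↭ : ∀ {P Q} → P ↭ Q → innerSize P ≡ innerSize Q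
  innerSize-↭ P↭Q = sum-↭ (map⁺ (length ∘ inner) P↭Q)

  innerSize-flowAlong : ∀ s t σ → innerSize (flowAlong s t σ) ℕ.≤ length (interior σ)
  innerSize-flowAlong s t σ with FinP.<-cmp s t
  ... | tri< _ _ _ = ℕP.≤-reflexive (ℕP.+-identityʳ _)
  ... | tri≈ _ _ _ = ℕ.z≤n
  ... | tri> _ _ _ = ℕP.≤-reflexive (trans (ℕP.+-identityʳ _) (ListP.length-reverse (interior σ)))

  -- Splitting off x units of the flow between two terminals

  record Extraction (R : List (FlowPath N)) (s t : Fin k) (x : ℚ) : Set where
    field
      rest            : List (FlowPath N)
      segments        : List (Segment (Fin n))
      rest-nonNeg     : AmountsNonNeg rest
      segments-nonNeg : All (λ σ → 0ℚ ≤ weight σ) segments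
      weights-sum     : ∑ weight segments ≡ x
      load-split      : ∀ u v → load N R u v ≡ load N rest u v + ∑ (λ σ → segmentLoad s t σ u v) segments
      sent-split      : ∀ α β → sent N R α β ≡ sent N rest α β + pairDemand s t x α β

    rest-routes : ∀ {e} → sent N R ≈ᵈ (pairDemand s t x +ᵈ e) → sent N rest ≈ᵈ e
    rest-routes {e} sent≈ α β α<β = +-cancelʳ (pairDemand s t x α β) _ _ (begin
      sent N rest α β + pairDemand s t x α β   ≡⟨ sym (sent-split α β) ⟩
      sent N R α β                             ≡⟨ sent≈ α β α<β ⟩
      pairDemand s t x α β + e α β             ≡⟨ ℚP.+-comm _ (e α β) ⟩
      e α β + pairDemand s t x α β             ∎)
      where open ≡-Reasoning

  -- Every s → t path of R gives up the fraction c of its amount; for the other paths the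
  -- orientedDemand at (s , t) is 0, so they give up nothing.
  takeFrom : Fin k → Fin k → ℚ → FlowPath N → Segment (Fin n)
  takeFrom s t c p = segment (inner p) (c * orientedDemand (src p) (tgt p) (amount p) s t)

  keepFrom : Fin k → Fin k → ℚ → FlowPath N → FlowPath N
  keepFrom s t c p = record p { amount = amount p - weight (takeFrom s t c p) }

  takeFrom-cases : ∀ s t c p → (src p ≡ s × tgt p ≡ t) ⊎ weight (takeFrom s t c p) ≡ 0ℚ
  takeFrom-cases s t c p with src p F.≟ s | tgt p F.≟ t
  ... | yes src≡s | yes tgt≡t = inj₁ (src≡s , tgt≡t)
  ... | no _      | _         = inj₂ (ℚP.*-zeroʳ c)
  ... | yes _     | no _      = inj₂ (ℚP.*-zeroʳ c)

  segmentLoad-takeFrom : ∀ s t c p u v →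
    segmentLoad s t (takeFrom s t c p) u v ≡ weight (takeFrom s t c p) * traversals (vertices N p) u v
  segmentLoad-takeFrom s t c p u v with takeFrom-cases s t c p
  ... | inj₁ (refl , refl) = refl
  ... | inj₂ w≡0           = zero-weight _ _ w≡0

  pairDemand-takeFrom : ∀ s t c p α β →
    pairDemand s t (weight (takeFrom s t c p)) α β ≡ pairDemand (src p) (tgt p) (weight (takeFrom s t c p)) α β
  pairDemand-takeFrom s t c p α β with takeFrom-cases s t c p
  ... | inj₁ (refl , refl) = refl
  ... | inj₂ w≡0           = begin
    pairDemand s t w α β                 ≡⟨ pairDemand-scale s t w α β ⟩
    w * pairDemand s t 1ℚ α β            ≡⟨ zero-weight _ _ w≡0 ⟩
    w * pairDemand (src p) (tgt p) 1ℚ α β ≡⟨ sym (pairDemand-scale (src p) (tgt p) w α β) ⟩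
    pairDemand (src p) (tgt p) w α β     ∎
    where
    open ≡-Reasoning
    w = weight (takeFrom s t c p)

  pathLoad-keepFrom+takeFrom : ∀ s t c p u v →
    pathLoad N u v (keepFrom s t c p) + segmentLoad s t (takeFrom s t c p) u v ≡ pathLoad N u v p
  pathLoad-keepFrom+takeFrom s t c p u v = begin
    pathLoad N u v (keepFrom s t c p) + segmentLoad s t (takeFrom s t c p) u v
      ≡⟨ cong₂ _+_ (pathLoad≡segmentLoad (keepFrom s t c p) u v) (segmentLoad-takeFrom s t c p u v) ⟩
    (a - w) * T + w * T
      ≡⟨ solve 3 (λ a w T → (a :- w) :* T :+ w :* T := a :* T) refl a w T ⟩
    a * T
      ≡⟨ sym (pathLoad≡segmentLoad p u v) ⟩
    pathLoad N u v p ∎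
    where
    open ≡-Reasoning
    a = amount p
    w = weight (takeFrom s t c p)
    T = traversals (vertices N p) u v

  orientedDemand-keepFrom+takeFrom : ∀ s t c p α β →
    orientedDemand (src p) (tgt p) (amount (keepFrom s t c p)) α β + pairDemand s t (weight (takeFrom s t c p)) α β
      ≡ orientedDemand (src p) (tgt p) (amount p) α β
  orientedDemand-keepFrom+takeFrom s t c p α β = begin
    orientedDemand (src p) (tgt p) (a - w) α β + pairDemand s t w α β
      ≡⟨ cong₂ _+_ (sym (pairDemand-< (a - w) α β (src<tgt p))) (pairDemand-takeFrom s t c p α β) ⟩
    pairDemand (src p) (tgt p) (a - w) α β + pairDemand (src p) (tgt p) w α β
      ≡⟨ sym (pairDemand-+ (src p) (tgt p) (a - w) w α β) ⟩
    pairDemand (src p) (tgt p) (a - w + w) α β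
      ≡⟨ cong (λ z → pairDemand (src p) (tgt p) z α β) (solve 2 (λ a w → a :- w :+ w := a) refl a w) ⟩
    pairDemand (src p) (tgt p) a α β
      ≡⟨ pairDemand-< a α β (src<tgt p) ⟩
    orientedDemand (src p) (tgt p) a α β ∎
    where
    open ≡-Reasoning
    a = amount p
    w = weight (takeFrom s t c p)

  takeFrom-nonNeg : ∀ s t {c} p → 0ℚ ≤ c → 0ℚ ≤ amount p → 0ℚ ≤ weight (takeFrom s t c p)
  takeFrom-nonNeg s t p 0≤c 0≤a = *-nonNeg 0≤c (if-nonNeg _ 0≤a)

  keepFrom-nonNeg : ∀ s t {c} p → 0ℚ ≤ c → c ≤ 1ℚ → 0ℚ ≤ amount p → 0ℚ ≤ amount (keepFrom s t c p)
  keepFrom-nonNeg s t {c} p 0≤c c≤1 0≤a = p≤q⇒0≤q-p (begin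
    c * od                ≤⟨ ℚP.*-monoʳ-≤-nonNeg od {{nonNegative 0≤od}} c≤1 ⟩
    1ℚ * od               ≡⟨ ℚP.*-identityˡ od ⟩
    od                    ≤⟨ if-≤ _ 0≤a ⟩
    amount p              ∎)
    where
    open ℚP.≤-Reasoning
    od = orientedDemand (src p) (tgt p) (amount p) s t
    0≤od = if-nonNeg (⌊ src p F.≟ s ⌋ ∧ ⌊ tgt p F.≟ t ⌋) 0≤a

  load-keepFrom+takeFrom : ∀ s t c R u v → load N R u v
    ≡ load N (map (keepFrom s t c) R) u v + ∑ (λ σ → segmentLoad s t σ u v) (map (takeFrom s t c) R)
  load-keepFrom+takeFrom s t c R u v = sym (begin
    load N (map keep R) u v + ∑ (λ σ → segmentLoad s t σ u v) (map take R)
      ≡⟨ cong₂ _+_ (∑-map (pathLoad N u v) keep R) (∑-map (λ σ → segmentLoad s t σ u v) take R) ⟩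
    ∑ (λ p → pathLoad N u v (keep p)) R + ∑ (λ p → segmentLoad s t (take p) u v) R
      ≡⟨ sym (∑-+ (λ p → pathLoad N u v (keep p)) (λ p → segmentLoad s t (take p) u v) R) ⟩
    ∑ (λ p → pathLoad N u v (keep p) + segmentLoad s t (take p) u v) R
      ≡⟨ ∑-cong (λ p → pathLoad-keepFrom+takeFrom s t c p u v) R ⟩
    load N R u v ∎)
    where
    open ≡-Reasoning
    keep = keepFrom s t c
    take = takeFrom s t c

  weights-takeFrom : ∀ s t c R → ∑ weight (map (takeFrom s t c) R) ≡ c * sent N R s t
  weights-takeFrom s t c R = trans (∑-map weight (takeFrom s t c) R) (∑-*ˡ c _ R)

  sent-keepFrom+takeFrom : ∀ s t c R α β →
    sent N R α β ≡ sent N (map (keepFrom s t c) R) α β + pairDemand s t (c * sent N R s t) α β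
  sent-keepFrom+takeFrom s t c R α β = sym (begin
    sent N (map keep R) α β + pairDemand s t (c * sent N R s t) α β
      ≡⟨ cong₂ _+_ (∑-map _ keep R) (cong (λ z → pairDemand s t z α β) (sym (∑-*ˡ c _ R))) ⟩
    ∑ kept R + pairDemand s t (∑ (weight ∘ take) R) α β
      ≡⟨ cong (∑ kept R +_) (sym (∑-pairDemand s t (weight ∘ take) R α β)) ⟩
    ∑ kept R + ∑ taken R
      ≡⟨ sym (∑-+ kept taken R) ⟩
    ∑ (λ p → kept p + taken p) R
      ≡⟨ ∑-cong (λ p → orientedDemand-keepFrom+takeFrom s t c p α β) R ⟩
    sent N R α β ∎)
    where
    open ≡-Reasoning
    keep = keepFrom s t c
    take = takeFrom s t c
    kept = λ p → orientedDemand (src p) (tgt p) (amount (keep p)) α β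
    taken = λ p → pairDemand s t (weight (take p)) α β

  extract-< : ∀ {s t x} R → s F.< t → 0ℚ < x → x ≤ sent N R s t → AmountsNonNeg R → Extraction R s t x
  extract-< {s} {t} {x} R s<t 0<x x≤S nonNeg = record
    { rest            = map (keepFrom s t c) R
    ; segments        = map (takeFrom s t c) R
    ; rest-nonNeg     = AllP.map⁺ (All.map (λ {p} → keepFrom-nonNeg s t p 0≤c c≤1) nonNeg)
    ; segments-nonNeg = AllP.map⁺ (All.map (λ {p} → takeFrom-nonNeg s t p 0≤c) nonNeg)
    ; weights-sum     = trans (weights-takeFrom s t c R) c*S≡x
    ; load-split      = load-keepFrom+takeFrom s t c R
    ; sent-split      = λ α β → trans (sent-keepFrom+takeFrom s t c R α β)
        (cong (λ z → sent N (map (keepFrom s t c) R) α β + pairDemand s t z α β) c*S≡x)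
    }
    where
    S = sent N R s t
    0<S : 0ℚ < S
    0<S = ℚP.<-≤-trans 0<x x≤S
    instance
      S≢0 : NonZero S
      S≢0 = >-nonZero 0<S
    c = x ÷ S
    0≤c : 0ℚ ≤ c
    0≤c = *-nonNeg (ℚP.<⇒≤ 0<x) (1/-nonNeg S 0<S)
    c≤1 : c ≤ 1ℚ
    c≤1 = ℚP.≤-trans (ℚP.*-monoʳ-≤-nonNeg (1/ S) {{nonNegative (1/-nonNeg S 0<S)}} x≤S)
                     (ℚP.≤-reflexive (ℚP.*-inverseʳ S))
    c*S≡x : c * S ≡ x
    c*S≡x = trans (ℚP.*-assoc x (1/ S) S) (trans (cong (x *_) (ℚP.*-inverseˡ S)) (ℚP.*-identityʳ x))

  flipExtraction : ∀ {R s t x} → Extraction R t s x → Extraction R s t x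
  flipExtraction {R} {s} {t} {x} e = record
    { rest            = rest
    ; segments        = map reverseSegment segments
    ; rest-nonNeg     = rest-nonNeg
    ; segments-nonNeg = AllP.map⁺ segments-nonNeg
    ; weights-sum     = trans (∑-map weight reverseSegment segments) weights-sum
    ; load-split      = λ u v → trans (load-split u v) (cong (load N rest u v +_) (sym
        (trans (∑-map _ reverseSegment segments) (∑-cong (λ σ → segmentLoad-reverse s t σ u v) segments))))
    ; sent-split      = λ α β → trans (sent-split α β) (cong (sent N rest α β +_) (pairDemand-sym t s x α β))
    }
    where open Extraction e

  extract : ∀ {s t x} R → s ≢ t → 0ℚ < x → pairDemand s t x ≤ᵈ sent N R → AmountsNonNeg R → Extraction R s t x
  extract {s} {t} {x} R s≢t 0<x x≤sent nonNeg with FinP.<-cmp s t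
  ... | tri< s<t _ _ = extract-< R s<t 0<x
        (subst (_≤ sent N R s t) (orientedDemand-self s t x) (x≤sent s t s<t)) nonNeg
  ... | tri≈ _ s≡t _ = ⊥-elim (s≢t s≡t)
  ... | tri> _ _ t<s = flipExtraction (extract-< R t<s 0<x
        (subst (_≤ sent N R t s) (orientedDemand-self t s x) (x≤sent t s t<s)) nonNeg)

  -- Concatenating two flows of value x at a terminal

  -- With weight w w′ / x, summing over τ (total weight x) gives back w and summing over σ gives
  -- back w′, so the joined walks carry exactly the load of the two flows.
  join : Fin k → (x : ℚ) .{{_ : NonZero x}} → Segment (Fin n) → Segment (Fin n) → Segment (Fin n)
  join j x σ τ = segment (interior σ ++ term j ∷ interior τ) (weight σ * (weight τ ÷ x))

  joinAll : Fin k → Fin k → Fin k → (x : ℚ) .{{_ : NonZero x}} →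
            List (Segment (Fin n)) → List (Segment (Fin n)) → List (FlowPath N)
  joinAll s j t x σs τs = concatMap (λ σ → concatMap (λ τ → flowAlong s t (join j x σ τ)) τs) σs

  module JoinAll (s j t : Fin k) (x : ℚ) {{_ : NonZero x}} (σs τs : List (Segment (Fin n)))
                 (σs-sum : ∑ weight σs ≡ x) (τs-sum : ∑ weight τs ≡ x) where

    private
      ∑-joinAll : ∀ (f : FlowPath N → ℚ) →
        ∑ f (joinAll s j t x σs τs) ≡ ∑ (λ σ → ∑ (λ τ → ∑ f (flowAlong s t (join j x σ τ))) τs) σs
      ∑-joinAll f = trans (∑-concatMap f (λ σ → concatMap (λ τ → flowAlong s t (join j x σ τ)) τs) σs)
                          (∑-cong (λ σ → ∑-concatMap f (λ τ → flowAlong s t (join j x σ τ)) τs) σs)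

      ∑-weight÷x : ∀ (ρs : List (Segment (Fin n))) → ∑ weight ρs ≡ x → ∑ (λ ρ → weight ρ * 1/ x) ρs ≡ 1ℚ
      ∑-weight÷x ρs sum≡x = trans (∑-*ʳ (1/ x) weight ρs) (trans (cong (_* 1/ x) sum≡x) (ℚP.*-inverseʳ x))

    joinAll-nonNeg : 0ℚ < x → All (λ σ → 0ℚ ≤ weight σ) σs → All (λ τ → 0ℚ ≤ weight τ) τs →
                     AmountsNonNeg (joinAll s j t x σs τs)
    joinAll-nonNeg 0<x σs≥0 τs≥0 = concatMap⁺ σs≥0 (λ {σ} 0≤wσ → concatMap⁺ τs≥0 (λ {τ} 0≤wτ →
      flowAlong-nonNeg s t (join j x σ τ) (*-nonNeg 0≤wσ (*-nonNeg 0≤wτ (1/-nonNeg x 0<x)))))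
      where
      concatMap⁺ : ∀ {A B : Set} {P : A → Set} {Q : B → Set} {f : A → List B} {xs} →
                   All P xs → (∀ {a} → P a → All Q (f a)) → All Q (concatMap f xs)
      concatMap⁺ Pxs P⇒Q = AllP.concat⁺ (AllP.map⁺ (All.map P⇒Q Pxs))

    load-joinAll : s ≢ t → ∀ u v → load N (joinAll s j t x σs τs) u v
                   ≡ ∑ (λ σ → segmentLoad s j σ u v) σs + ∑ (λ τ → segmentLoad j t τ u v) τs
    load-joinAll s≢t u v = begin
      load N (joinAll s j t x σs τs) u v
        ≡⟨ ∑-joinAll (pathLoad N u v) ⟩
      ∑ (λ σ → ∑ (λ τ → load N (flowAlong s t (join j x σ τ)) u v) τs) σs
        ≡⟨ ∑-cong (λ σ → ∑-cong (λ τ → trans (load-flowAlong-≢ (join j x σ τ) s≢t u v) (split σ τ)) τs) σs ⟩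
      ∑ (λ σ → ∑ (λ τ → L₁ σ * i τ + i σ * L₂ τ) τs) σs
        ≡⟨ trans (∑-cong (λ σ → ∑-+ (λ τ → L₁ σ * i τ) (λ τ → i σ * L₂ τ) τs) σs) (∑-+ _ _ σs) ⟩
      ∑ (λ σ → ∑ (λ τ → L₁ σ * i τ) τs) σs + ∑ (λ σ → ∑ (λ τ → i σ * L₂ τ) τs) σs
        ≡⟨ cong₂ _+_ (∑-product L₁ i σs τs) (∑-product i L₂ σs τs) ⟩
      ∑ L₁ σs * ∑ i τs + ∑ i σs * ∑ L₂ τs
        ≡⟨ cong₂ _+_ (cong (∑ L₁ σs *_) (∑-weight÷x τs τs-sum)) (cong (_* ∑ L₂ τs) (∑-weight÷x σs σs-sum)) ⟩
      ∑ L₁ σs * 1ℚ + 1ℚ * ∑ L₂ τs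
        ≡⟨ cong₂ _+_ (ℚP.*-identityʳ (∑ L₁ σs)) (ℚP.*-identityˡ (∑ L₂ τs)) ⟩
      ∑ L₁ σs + ∑ L₂ τs ∎
      where
      open ≡-Reasoning
      L₁ = λ σ → segmentLoad s j σ u v
      L₂ = λ τ → segmentLoad j t τ u v
      i = λ ρ → weight ρ * 1/ x
      split : ∀ σ τ → segmentLoad s t (join j x σ τ) u v ≡ L₁ σ * i τ + i σ * L₂ τ
      split σ τ =
        trans (cong (weight σ * (weight τ * 1/ x) *_) (traversals-split s j t (interior σ) (interior τ) u v))
          (solve 5 (λ a b r p q → (a :* (b :* r)) :* (p :+ q) := (a :* p) :* (b :* r) :+ (a :* r) :* (b :* q)) refl
            (weight σ) (weight τ) (1/ x)
            (traversals (walk s j (interior σ)) u v) (traversals (walk j t (interior τ)) u v))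

    sent-joinAll : ∀ α β → sent N (joinAll s j t x σs τs) α β ≡ pairDemand s t x α β
    sent-joinAll α β = begin
      sent N (joinAll s j t x σs τs) α β
        ≡⟨ ∑-joinAll _ ⟩
      ∑ (λ σ → ∑ (λ τ → sent N (flowAlong s t (join j x σ τ)) α β) τs) σs
        ≡⟨ ∑-cong (λ σ → trans (∑-cong (λ τ → sent-flowAlong s t (join j x σ τ) α β) τs)
                               (∑-pairDemand s t (λ τ → weight σ * (weight τ ÷ x)) τs α β)) σs ⟩
      ∑ (λ σ → pairDemand s t (∑ (λ τ → weight σ * (weight τ ÷ x)) τs) α β) σs
        ≡⟨ ∑-pairDemand s t _ σs α β ⟩
      pairDemand s t (∑ (λ σ → ∑ (λ τ → weight σ * (weight τ ÷ x)) τs) σs) α β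
        ≡⟨ cong (λ z → pairDemand s t z α β) total ⟩
      pairDemand s t x α β ∎
      where
      open ≡-Reasoning
      total : ∑ (λ σ → ∑ (λ τ → weight σ * (weight τ ÷ x)) τs) σs ≡ x
      total = trans (∑-product weight (λ τ → weight τ ÷ x) σs τs)
        (trans (cong₂ _*_ σs-sum (∑-weight÷x τs τs-sum)) (ℚP.*-identityʳ x))

  shortcutVia : ∀ {s j t x e} → s ≢ j → j ≢ t → s ≢ t → 0ℚ < x → IsDemand e →
                Routable N (pairDemand s j x +ᵈ (pairDemand j t x +ᵈ e)) → Routable N (pairDemand s t x +ᵈ e)
  shortcutVia {s} {j} {t} {x} {e} s≢j j≢t s≢t 0<x e≥0 (R , nonNeg , fits , sends) =
    joined ++ E₂.rest ,
    AllP.++⁺ (joinAll-nonNeg 0<x E₁.segments-nonNeg E₂.segments-nonNeg) E₂.rest-nonNeg ,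
    (λ u v → subst (_≤ cap u v) (sym (load≡ u v)) (fits u v)) ,
    λ α β α<β → trans (sent-++ joined E₂.rest α β) (cong₂ _+_ (sent-joinAll α β) (sends₂ α β α<β))
    where
    instance
      x≢0 : NonZero x
      x≢0 = >-nonZero 0<x
    0≤x = ℚP.<⇒≤ 0<x
    module E₁ = Extraction (extract R s≢j 0<x
      (pairDemand-≤ᵈ {s = s} {t = j} sends (IsDemand-pairDemand-+ᵈ {s = j} {t = t} 0≤x e≥0)) nonNeg)
    sends₁ : sent N E₁.rest ≈ᵈ (pairDemand j t x +ᵈ e)
    sends₁ = E₁.rest-routes sends
    module E₂ = Extraction (extract E₁.rest j≢t 0<x (pairDemand-≤ᵈ {s = j} {t = t} sends₁ e≥0) E₁.rest-nonNeg)
    sends₂ : sent N E₂.rest ≈ᵈ e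
    sends₂ = E₂.rest-routes sends₁
    open JoinAll s j t x E₁.segments E₂.segments E₁.weights-sum E₂.weights-sum
    joined = joinAll s j t x E₁.segments E₂.segments
    load≡ : ∀ u v → load N (joined ++ E₂.rest) u v ≡ load N R u v
    load≡ u v = begin
      load N (joined ++ E₂.rest) u v           ≡⟨ load-++ joined E₂.rest u v ⟩
      load N joined u v + load N E₂.rest u v   ≡⟨ cong (_+ load N E₂.rest u v) (load-joinAll s≢t u v) ⟩
      (Σ₁ + Σ₂) + load N E₂.rest u v           ≡⟨ solve 3 (λ a b c → (a :+ b) :+ c := (c :+ b) :+ a) refl
                                                       Σ₁ Σ₂ (load N E₂.rest u v) ⟩
      (load N E₂.rest u v + Σ₂) + Σ₁           ≡⟨ cong (_+ Σ₁) (sym (E₂.load-split u v)) ⟩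
      load N E₁.rest u v + Σ₁                  ≡⟨ sym (E₁.load-split u v) ⟩
      load N R u v                             ∎
      where
      open ≡-Reasoning
      Σ₁ = ∑ (λ σ → segmentLoad s j σ u v) E₁.segments
      Σ₂ = ∑ (λ τ → segmentLoad j t τ u v) E₂.segments

  shortcut : ∀ {s j t x e} → s ≢ t → 0ℚ ≤ x → IsDemand e →
             Routable N (pairDemand s j x +ᵈ (pairDemand j t x +ᵈ e)) → Routable N (pairDemand s t x +ᵈ e)
  shortcut {s} {j} {t} {x} {e} s≢t 0≤x e≥0 routable with s F.≟ j | j F.≟ t | ℚP.<-cmp 0ℚ x
  ... | yes refl | _        | _ = Routable-resp-≈ᵈ (λ α β _ →
        trans (cong (_+ (pairDemand s t x α β + e α β)) (pairDemand-self s x α β)) (ℚP.+-identityˡ _)) routable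
  ... | no _     | yes refl | _ = Routable-resp-≈ᵈ (λ α β _ →
        cong (pairDemand s j x α β +_) (trans (cong (_+ e α β) (pairDemand-self j x α β)) (ℚP.+-identityˡ _)))
        routable
  ... | no s≢j   | no j≢t   | tri< 0<x _ _ = shortcutVia s≢j j≢t s≢t 0<x e≥0 routable
  ... | no _     | no _     | tri≈ _ refl _ = Routable-resp-≈ᵈ (λ α β _ → begin
        pairDemand s j 0ℚ α β + (pairDemand j t 0ℚ α β + e α β)
          ≡⟨ cong₂ (λ a b → a + (b + e α β)) (pairDemand-0 s j α β) (pairDemand-0 j t α β) ⟩
        0ℚ + (0ℚ + e α β)
          ≡⟨ ℚP.+-identityˡ _ ⟩
        0ℚ + e α β
          ≡⟨ cong (_+ e α β) (sym (pairDemand-0 s t α β)) ⟩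
        pairDemand s t 0ℚ α β + e α β ∎) routable
    where open ≡-Reasoning
  ... | no _     | no _     | tri> _ _ x<0 = ⊥-elim (ℚP.<-irrefl refl (ℚP.<-≤-trans x<0 0≤x))

  -- Cutting a path at an inner terminal

  splitAt : FlowPath N → Fin k → List (Fin n) → List (Fin n) → List (FlowPath N)
  splitAt p j i₁ i₂ = flowAlong (src p) j (segment i₁ (amount p)) ++ flowAlong j (tgt p) (segment i₂ (amount p))

  module _ (p : FlowPath N) (j : Fin k) (i₁ i₂ : List (Fin n)) (inner≡ : inner p ≡ i₁ ++ term j ∷ i₂) where

    load-splitAt : 0ℚ ≤ amount p → ∀ u v → load N (splitAt p j i₁ i₂) u v ≤ pathLoad N u v p
    load-splitAt 0≤a u v = begin
      load N (splitAt p j i₁ i₂) u v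
        ≡⟨ load-++ (flowAlong (src p) j σ₁) (flowAlong j (tgt p) σ₂) u v ⟩
      load N (flowAlong (src p) j σ₁) u v + load N (flowAlong j (tgt p) σ₂) u v
        ≤⟨ ℚP.+-mono-≤ (load-flowAlong (src p) j σ₁ 0≤a u v) (load-flowAlong j (tgt p) σ₂ 0≤a u v) ⟩
      amount p * traversals (walk (src p) j i₁) u v + amount p * traversals (walk j (tgt p) i₂) u v
        ≡⟨ sym (ℚP.*-distribˡ-+ (amount p) _ _) ⟩
      amount p * (traversals (walk (src p) j i₁) u v + traversals (walk j (tgt p) i₂) u v)
        ≡⟨ cong (amount p *_) (sym (traversals-split (src p) j (tgt p) i₁ i₂ u v)) ⟩
      amount p * traversals (walk (src p) (tgt p) (i₁ ++ term j ∷ i₂)) u v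
        ≡⟨ cong (λ i → amount p * traversals (walk (src p) (tgt p) i) u v) (sym inner≡) ⟩
      segmentLoad (src p) (tgt p) (segmentOf p) u v
        ≡⟨ sym (pathLoad≡segmentLoad p u v) ⟩
      pathLoad N u v p ∎
      where
      open ℚP.≤-Reasoning
      σ₁ = segment i₁ (amount p)
      σ₂ = segment i₂ (amount p)

    Routes-splitAt : ∀ {d} P → Routes N d (p ∷ P) →
      Routes N (pairDemand (src p) j (amount p) +ᵈ (pairDemand j (tgt p) (amount p) +ᵈ sent N P))
               (splitAt p j i₁ i₂ ++ P)
    Routes-splitAt P (0≤a ∷ nonNeg , fits , _) =
      AllP.++⁺ (AllP.++⁺ (flowAlong-nonNeg (src p) j _ 0≤a) (flowAlong-nonNeg j (tgt p) _ 0≤a)) nonNeg ,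
      (λ u v → ℚP.≤-trans (load≤ u v) (fits u v)) ,
      λ α β _ → trans (sent-++ (splitAt p j i₁ i₂) P α β)
        (trans (cong (_+ sent N P α β)
                  (trans (sent-++ (flowAlong (src p) j _) (flowAlong j (tgt p) _) α β)
                         (cong₂ _+_ (sent-flowAlong (src p) j _ α β) (sent-flowAlong j (tgt p) _ α β))))
               (ℚP.+-assoc (pairDemand (src p) j (amount p) α β) (pairDemand j (tgt p) (amount p) α β)
                           (sent N P α β)))
      where
      load≤ : ∀ u v → load N (splitAt p j i₁ i₂ ++ P) u v ≤ load N (p ∷ P) u v
      load≤ u v = ℚP.≤-trans (ℚP.≤-reflexive (load-++ (splitAt p j i₁ i₂) P u v))
                             (ℚP.+-monoˡ-≤ (load N P u v) (load-splitAt 0≤a u v))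

    innerSize-splitAt : ∀ P → innerSize (splitAt p j i₁ i₂ ++ P) ℕ.< innerSize (p ∷ P)
    innerSize-splitAt P = begin-strict
      innerSize (splitAt p j i₁ i₂ ++ P)
        ≡⟨ innerSize-++ (splitAt p j i₁ i₂) P ⟩
      innerSize (splitAt p j i₁ i₂) ℕ.+ innerSize P
        ≡⟨ cong (ℕ._+ innerSize P) (innerSize-++ (flowAlong (src p) j _) (flowAlong j (tgt p) _)) ⟩
      (innerSize (flowAlong (src p) j _) ℕ.+ innerSize (flowAlong j (tgt p) _)) ℕ.+ innerSize P
        ≤⟨ ℕP.+-monoˡ-≤ (innerSize P) (ℕP.+-mono-≤ (innerSize-flowAlong (src p) j (segment i₁ (amount p)))
                                                   (innerSize-flowAlong j (tgt p) (segment i₂ (amount p)))) ⟩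
      (length i₁ ℕ.+ length i₂) ℕ.+ innerSize P
        <⟨ ℕP.+-monoˡ-< (innerSize P) (ℕP.+-monoʳ-< (length i₁) (ℕP.n<1+n (length i₂))) ⟩
      (length i₁ ℕ.+ length (term j ∷ i₂)) ℕ.+ innerSize P
        ≡⟨ cong (ℕ._+ innerSize P) (sym (trans (cong length inner≡) (ListP.length-++ i₁))) ⟩
      innerSize (p ∷ P) ∎
      where open ℕP.≤-Reasoning

  record ThroughTerminal (P : List (FlowPath N)) : Set where
    field
      path        : FlowPath N
      others      : List (FlowPath N)
      reordering  : P ↭ path ∷ others
      terminal    : Fin k
      before      : List (Fin n)
      after       : List (Fin n)
      inner-split : inner path ≡ before ++ term terminal ∷ after

  terminalFree⊎throughTerminal : ∀ P → All (TerminalFree N) P ⊎ ThroughTerminal P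
  terminalFree⊎throughTerminal P with any? (λ p → FinP.any? (λ j → any? (term j F.≟_) (inner p))) P
  ... | no none = inj₁ (All.map (λ {p} → noneInside {p}) (AllP.¬Any⇒All¬ P none))
    where
    noneInside : ∀ {p} → ¬ (∃ λ j → term j ∈ inner p) → TerminalFree N p
    noneInside {p} none = All.tabulate (λ v∈ j term≡v → none (j , subst (_∈ inner p) (sym term≡v) v∈))
  ... | yes some with find some
  ...   | p , p∈P , j , j∈p with ∈-∃++ p∈P | ∈-∃++ j∈p
  ...     | pre , post , refl | i₁ , i₂ , inner≡ = inj₂ (record
    { path = p ; others = pre ++ post ; reordering = shift p pre post
    ; terminal = j ; before = i₁ ; after = i₂ ; inner-split = inner≡ })

module _ {k : ℕ} (Ga Gb : Network k) (ρ : ℚ) (1≤ρ : 1ℚ ≤ ρ)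
         (terminalFree⇒scaled : ∀ d → IsDemand d → RoutableTerminalFree Ga d → Routable Gb (scaleDown ρ 1≤ρ d)) where

  private
    0<ρ : 0ℚ < ρ
    0<ρ = ℚP.<-≤-trans 0<1 1≤ρ

    instance
      ρ≢0 : NonZero ρ
      ρ≢0 = >-nonZero 0<ρ

  scaleDown-pairDemand-+ᵈ : ∀ (s t : Fin k) a (e : Demand k) α β →
    scaleDown ρ 1≤ρ (pairDemand s t a +ᵈ e) α β ≡ (pairDemand s t (a ÷ ρ) +ᵈ scaleDown ρ 1≤ρ e) α β
  scaleDown-pairDemand-+ᵈ s t a e α β =
    trans (ℚP.*-distribʳ-+ (1/ ρ) (pairDemand s t a α β) (e α β))
          (cong (_+ scaleDown ρ 1≤ρ e α β) (pairDemand-*ʳ s t a (1/ ρ) α β))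

  routable⇒scaled : ∀ {d} P → Acc ℕ._<_ (innerSize Ga P) → Routes Ga d P → Routable Gb (scaleDown ρ 1≤ρ d)
  routable⇒scaled {d} P (acc smaller) routes with terminalFree⊎throughTerminal Ga P
  ... | inj₁ terminalFree = terminalFree⇒scaled d (Routes⇒IsDemand Ga routes) (P , routes , terminalFree)
  ... | inj₂ through =
    Routable-resp-≈ᵈ Gb scaleDown-joined (shortcut Gb (FinP.<⇒≢ (src<tgt path)) 0≤x rest≥0
      (Routable-resp-≈ᵈ Gb (λ α β _ → scaleDown-split α β)
        (routable⇒scaled P′ (smaller shrinks) (Routes-splitAt Ga path j before after inner-split others reordered))))
    where
    open ThroughTerminal through
    s = src path
    t = tgt path
    j = terminal
    a = amount path
    rest = sent Ga others
    reordered : Routes Ga d (path ∷ others)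
    reordered = Routes-resp-↭ Ga reordering routes
    P′ = splitAt Ga path j before after ++ others
    shrinks : innerSize Ga P′ ℕ.< innerSize Ga P
    shrinks = subst (innerSize Ga P′ ℕ.<_) (sym (innerSize-↭ Ga reordering))
                    (innerSize-splitAt Ga path j before after inner-split others)
    1/ρ≥0 = 1/-nonNeg ρ 0<ρ
    0≤x : 0ℚ ≤ a ÷ ρ
    0≤x = *-nonNeg (All.head (proj₁ reordered)) 1/ρ≥0
    rest≥0 : IsDemand (scaleDown ρ 1≤ρ rest)
    rest≥0 α β _ = *-nonNeg (sent-nonNeg Ga (All.tail (proj₁ reordered)) α β) 1/ρ≥0
    scaleDown-split : ∀ α β → scaleDown ρ 1≤ρ (pairDemand s j a +ᵈ (pairDemand j t a +ᵈ rest)) α β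
                      ≡ (pairDemand s j (a ÷ ρ) +ᵈ (pairDemand j t (a ÷ ρ) +ᵈ scaleDown ρ 1≤ρ rest)) α β
    scaleDown-split α β = trans (scaleDown-pairDemand-+ᵈ s j a (pairDemand j t a +ᵈ rest) α β)
                                (cong (pairDemand s j (a ÷ ρ) α β +_) (scaleDown-pairDemand-+ᵈ j t a rest α β))
    scaleDown-joined : (pairDemand s t (a ÷ ρ) +ᵈ scaleDown ρ 1≤ρ rest) ≈ᵈ scaleDown ρ 1≤ρ d
    scaleDown-joined α β α<β = trans (sym (scaleDown-pairDemand-+ᵈ s t a rest α β))
      (cong (_÷ ρ) (trans (sym (sent-∷ Ga path others α β)) (proj₂ (proj₂ reordered) α β α<β)))

lemma5p1 : (k : ℕ) (Ga Gb : Network k) (ρ : ℚ) (1≤ρ : 1ℚ ≤ ρ)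
    → (∀ (d : Demand k) → IsDemand d → RoutableTerminalFree Ga d → Routable Gb (scaleDown ρ 1≤ρ d))
    → ∀ (d : Demand k) → IsDemand d → Routable Ga d → Routable Gb (scaleDown ρ 1≤ρ d)
lemma5p1 k Ga Gb ρ 1≤ρ terminalFree⇒scaled d _ (P , routes) =
  routable⇒scaled Ga Gb ρ 1≤ρ terminalFree⇒scaled P (<-wellFounded (innerSize Ga P)) routes
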